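{- For every forest $F$ with no isolated vertices, $\gamma(F)\le\frac12\big(|\mathit{Deg}_{\ge2}(F)|+|\mathit{Supp}(F)|\big)$.
   Context: $\gamma(F)$ is the size of a minimum dominating set of $F$. $\mathit{Deg}_{\ge2}(F)$ is the set of vertices of degree at least $2$; $\mathit{Supp}(F)$ is the set of support vertices, i.e., vertices adjacent to at least one leaf (vertex of degree $1$). -}

module Defs where

open import Data.Nat using (ℕ; zero; suc; _+_; _*_; _≤_; _≥_; _<_)
open import Data.Bool using (Bool; true; false; T)
open import Data.Fin using (Fin)
open import Data.Fin.Subset using (Subset; _∈_; ∣_∣)
open import Data.Fin.Subset using () renaming (⁅_⁆ to singleton)
open import Data.Vec using (tabulate)
open import Data.List using (List; []; _∷_; length)
open import Data.List.Relation.Unary.Unique.Propositional using (Unique)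
open import Data.Product using (∃; _×_; Σ)
open import Data.Empty using (⊥)
open import Relation.Nullary using (¬_; Dec; does)
open import Relation.Binary.PropositionalEquality using (_≡_)

record Graph (n : ℕ) : Set where
  field
    adj       : Fin n → Fin n → Bool
    adj-sym   : ∀ u v → adj u v ≡ adj v u
    adj-irr   : ∀ v → adj v v ≡ false
open Graph public

Adj : ∀ {n} → Graph n → Fin n → Fin n → Set
Adj G u v = T (adj G u v)

nbhd : ∀ {n} → Graph n → Fin n → Subset n
nbhd G v = tabulate (λ u → adj G v u)

degree : ∀ {n} → Graph n → Fin n → ℕ
degree G v = ∣ nbhd G v ∣

data Walk {n : ℕ} (G : Graph n) : List (Fin n) → Set where
  w-nil  : Walk G []
  w-one  : ∀ v → Walk G (v ∷ [])
  w-cons : ∀ u v vs → Adj G u v → Walk G (v ∷ vs) → Walk G (u ∷ v ∷ vs)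

last : ∀ {A : Set} → A → List A → A
last a [] = a
last a (b ∷ bs) = last b bs

IsCycle : ∀ {n} → Graph n → List (Fin n) → Set
IsCycle G [] = ⊥
IsCycle G (v ∷ vs) =
  Unique (v ∷ vs) × Walk G (v ∷ vs) × 3 ≤ length (v ∷ vs) × Adj G (last v vs) v

IsForest : ∀ {n} → Graph n → Set
IsForest G = ∀ (c : List (Fin n)) → ¬ IsCycle G c
  where n = _

NoIsolated : ∀ {n} → Graph n → Set
NoIsolated G = ∀ v → 1 ≤ degree G v

IsLeaf : ∀ {n} → Graph n → Fin n → Set
IsLeaf G v = degree G v ≡ 1

Dominating : ∀ {n} → Graph n → Subset n → Set
Dominating G D = ∀ v → v ∈ D ⊎' ∃ λ u → u ∈ D × Adj G v u
  where open import Data.Sum using () renaming (_⊎_ to _⊎'_)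

open import Data.Nat using (_≤ᵇ_)
open import Data.Bool using (_∧_; _∨_)
open import Data.Nat using (_≡ᵇ_)
open import Data.Vec using (foldr)
open import Data.Fin using (Fin)

anyFin : ∀ {n} → (Fin n → Bool) → Bool
anyFin {n} f = foldr _ _∨_ false (tabulate f)

Deg≥2 : ∀ {n} → Graph n → Subset n
Deg≥2 G = tabulate (λ v → 2 ≤ᵇ degree G v)

Supp : ∀ {n} → Graph n → Subset n
Supp G = tabulate (λ v → anyFin (λ u → adj G v u ∧ (degree G u ≡ᵇ 1)))

-- Let W = Deg≥2 ∪ Supp and R = Deg≥2 ∩ Supp. A vertex outside W is a leaf whose
-- neighbour lies in R, and a vertex outside R has a neighbour in W. Take Y ⊆ W
-- containing R, dominating W, and minimal with these properties. By Ore's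
-- private-neighbour argument (W ∖ Y) ∪ R dominates W as well, and the two sets
-- have |Y| + |(W ∖ Y) ∪ R| = |W| + |R| = |Deg≥2| + |Supp|. Both contain R, so
-- both dominate the whole graph, and the smaller one has at most half that size.
module Submission where

open import Defs
open import Data.Nat using (ℕ; zero; suc; _+_; _*_; _≤_; _<_; _≡ᵇ_)
open import Data.Nat.Properties using (+-suc; +-comm; +-assoc; +-identityʳ; +-monoʳ-≤; ≤-total; ≤-trans; ≤-reflexive; ≤ᵇ⇒≤; ≤⇒≤ᵇ; ≡ᵇ⇒≡; ≡⇒≡ᵇ; m≤n⇒m<n∨m≡n)
open import Data.Nat.Induction using (<-wellFounded)
open import Induction.WellFounded using (Acc; acc)
open import Data.Bool using (Bool; true; false; T; _∧_)
open import Data.Bool.Properties using (T-≡; T-∨; T-∧)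
open import Data.Fin using (Fin; zero; suc)
open import Data.Fin.Properties using (any?; all?; ¬∀⟶∃¬) renaming (_≟_ to _≟ᶠ_)
open import Data.Fin.Subset using (Subset; _∈_; _∉_; _⊆_; _∪_; _∩_; ∁; _-_; ⁅_⁆; ⊥; ∣_∣; Nonempty; Empty)
open import Data.Fin.Subset.Properties using (_∈?_; nonempty?; Empty-unique; ∣⊥∣≡0; ⊆-antisym; x∈p∩q⁺; x∈p∩q⁻; p∩q⊆p; p∩q⊆q; x∈p∪q⁺; x∈∁p⇒x∉p; x∉p⇒x∈∁p; x∈p∧x≢y⇒x∈p-y; p─q⊆p; p⊆p∪q; q⊆p∪q; ⊆-trans; x∈p⇒∣p-x∣<∣p∣)
open import Data.Vec using ([]; _∷_; tabulate)
open import Data.Vec.Properties using (lookup∘tabulate; lookup⇒[]=; []=⇒lookup)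
open import Data.Product using (Σ; ∃-syntax; _×_; _,_; proj₂)
open import Data.Sum using (_⊎_; inj₁; inj₂)
open import Function using (_∘_; id; _⇔_; mk⇔; Equivalence)
open import Relation.Nullary using (¬_; yes; no; contradiction)
open import Relation.Nullary.Decidable using (Dec; _×-dec_; _⊎-dec_; _→-dec_; ¬?; T?)
open import Relation.Binary.PropositionalEquality using (_≡_; refl; sym; trans; cong; subst; module ≡-Reasoning)

open Equivalence using (to; from)

∣p∪q∣+∣p∩q∣≡∣p∣+∣q∣ : ∀ {n} (p q : Subset n) → ∣ p ∪ q ∣ + ∣ p ∩ q ∣ ≡ ∣ p ∣ + ∣ q ∣
∣p∪q∣+∣p∩q∣≡∣p∣+∣q∣ []          []          = refl
∣p∪q∣+∣p∩q∣≡∣p∣+∣q∣ (true  ∷ p) (true  ∷ q) =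
  cong suc (trans (+-suc _ _) (trans (cong suc (∣p∪q∣+∣p∩q∣≡∣p∣+∣q∣ p q)) (sym (+-suc _ _))))
∣p∪q∣+∣p∩q∣≡∣p∣+∣q∣ (true  ∷ p) (false ∷ q) = cong suc (∣p∪q∣+∣p∩q∣≡∣p∣+∣q∣ p q)
∣p∪q∣+∣p∩q∣≡∣p∣+∣q∣ (false ∷ p) (true  ∷ q) =
  trans (cong suc (∣p∪q∣+∣p∩q∣≡∣p∣+∣q∣ p q)) (sym (+-suc _ _))
∣p∪q∣+∣p∩q∣≡∣p∣+∣q∣ (false ∷ p) (false ∷ q) = ∣p∪q∣+∣p∩q∣≡∣p∣+∣q∣ p q

∣p∩∁q∣+∣p∩q∣≡∣p∣ : ∀ {n} (p q : Subset n) → ∣ p ∩ ∁ q ∣ + ∣ p ∩ q ∣ ≡ ∣ p ∣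
∣p∩∁q∣+∣p∩q∣≡∣p∣ []          []          = refl
∣p∩∁q∣+∣p∩q∣≡∣p∣ (true  ∷ p) (true  ∷ q) = trans (+-suc _ _) (cong suc (∣p∩∁q∣+∣p∩q∣≡∣p∣ p q))
∣p∩∁q∣+∣p∩q∣≡∣p∣ (true  ∷ p) (false ∷ q) = cong suc (∣p∩∁q∣+∣p∩q∣≡∣p∣ p q)
∣p∩∁q∣+∣p∩q∣≡∣p∣ (false ∷ p) (true  ∷ q) = ∣p∩∁q∣+∣p∩q∣≡∣p∣ p q
∣p∩∁q∣+∣p∩q∣≡∣p∣ (false ∷ p) (false ∷ q) = ∣p∩∁q∣+∣p∩q∣≡∣p∣ p q

Empty[p∩q]⇒∣p∪q∣≡∣p∣+∣q∣ : ∀ {n} (p q : Subset n) → Empty (p ∩ q) → ∣ p ∪ q ∣ ≡ ∣ p ∣ + ∣ q ∣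
Empty[p∩q]⇒∣p∪q∣≡∣p∣+∣q∣ {n} p q empty = begin
  ∣ p ∪ q ∣               ≡⟨ sym (+-identityʳ _) ⟩
  ∣ p ∪ q ∣ + 0           ≡⟨ cong (∣ p ∪ q ∣ +_) (sym (∣⊥∣≡0 n)) ⟩
  ∣ p ∪ q ∣ + ∣ ⊥ {n} ∣   ≡⟨ cong (λ s → ∣ p ∪ q ∣ + ∣ s ∣) (sym (Empty-unique empty)) ⟩
  ∣ p ∪ q ∣ + ∣ p ∩ q ∣   ≡⟨ ∣p∪q∣+∣p∩q∣≡∣p∣+∣q∣ p q ⟩
  ∣ p ∣ + ∣ q ∣           ∎
  where open ≡-Reasoning

q⊆p⇒∣p∩∁q∣+∣q∣≡∣p∣ : ∀ {n} {p q : Subset n} → q ⊆ p → ∣ p ∩ ∁ q ∣ + ∣ q ∣ ≡ ∣ p ∣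
q⊆p⇒∣p∩∁q∣+∣q∣≡∣p∣ {p = p} {q} q⊆p =
  trans (cong (λ s → ∣ p ∩ ∁ q ∣ + ∣ s ∣) (sym p∩q≡q)) (∣p∩∁q∣+∣p∩q∣≡∣p∣ p q)
  where
  p∩q≡q : p ∩ q ≡ q
  p∩q≡q = ⊆-antisym (p∩q⊆q p q) (λ x∈q → x∈p∩q⁺ (q⊆p x∈q , x∈q))

∣q∣+∣[p∩∁q]∪r∣≡∣p∣+∣r∣ : ∀ {n} {p q r : Subset n} → r ⊆ q → q ⊆ p →
                          ∣ q ∣ + ∣ (p ∩ ∁ q) ∪ r ∣ ≡ ∣ p ∣ + ∣ r ∣
∣q∣+∣[p∩∁q]∪r∣≡∣p∣+∣r∣ {p = p} {q} {r} r⊆q q⊆p = begin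
  ∣ q ∣ + ∣ (p ∩ ∁ q) ∪ r ∣         ≡⟨ cong (∣ q ∣ +_) (Empty[p∩q]⇒∣p∪q∣≡∣p∣+∣q∣ (p ∩ ∁ q) r disjoint) ⟩
  ∣ q ∣ + (∣ p ∩ ∁ q ∣ + ∣ r ∣)     ≡⟨ sym (+-assoc ∣ q ∣ _ _) ⟩
  (∣ q ∣ + ∣ p ∩ ∁ q ∣) + ∣ r ∣     ≡⟨ cong (_+ ∣ r ∣) (+-comm ∣ q ∣ _) ⟩
  (∣ p ∩ ∁ q ∣ + ∣ q ∣) + ∣ r ∣     ≡⟨ cong (_+ ∣ r ∣) (q⊆p⇒∣p∩∁q∣+∣q∣≡∣p∣ q⊆p) ⟩
  ∣ p ∣ + ∣ r ∣                     ∎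
  where
  open ≡-Reasoning
  disjoint : Empty ((p ∩ ∁ q) ∩ r)
  disjoint (x , x∈) =
    let x∈p∩∁q , x∈r = x∈p∩q⁻ (p ∩ ∁ q) r x∈
    in x∈∁p⇒x∉p (proj₂ (x∈p∩q⁻ p (∁ q) x∈p∩∁q)) (r⊆q x∈r)

m≤n⇒2*m≤m+n : ∀ {m n} → m ≤ n → 2 * m ≤ m + n
m≤n⇒2*m≤m+n {m} m≤n = +-monoʳ-≤ m (subst (_≤ _) (sym (+-identityʳ m)) m≤n)

smaller-of-two : ∀ {n} {P : Subset n → Set} {s} D₁ D₂ → P D₁ → P D₂ → ∣ D₁ ∣ + ∣ D₂ ∣ ≡ s →
                 ∃[ D ] (P D × 2 * ∣ D ∣ ≤ s)
smaller-of-two D₁ D₂ p₁ p₂ sum with ≤-total ∣ D₁ ∣ ∣ D₂ ∣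
... | inj₁ ≤₂ = D₁ , p₁ , ≤-trans (m≤n⇒2*m≤m+n ≤₂) (≤-reflexive sum)
... | inj₂ ≤₁ = D₂ , p₂ , ≤-trans (m≤n⇒2*m≤m+n ≤₁) (≤-reflexive (trans (+-comm ∣ D₂ ∣ _) sum))

∈-tabulate : ∀ {n} {f : Fin n → Bool} {x} → x ∈ tabulate f ⇔ T (f x)
∈-tabulate {f = f} {x} = mk⇔
  (λ x∈ → from T-≡ (trans (sym (lookup∘tabulate f x)) ([]=⇒lookup x∈)))
  (λ fx → lookup⇒[]= x (tabulate f) (trans (lookup∘tabulate f x) (to T-≡ fx)))

T-anyFin : ∀ {n} {f : Fin n → Bool} → T (anyFin f) ⇔ (∃[ i ] T (f i))
T-anyFin {zero}      = mk⇔ (λ ()) (λ ())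
T-anyFin {suc n} {f} = mk⇔ found found⁻¹
  where
  found : T (anyFin f) → ∃[ i ] T (f i)
  found t with to T-∨ t
  ... | inj₁ f0 = zero , f0
  ... | inj₂ fs = let i , fi = to T-anyFin fs in suc i , fi
  found⁻¹ : ∃[ i ] T (f i) → T (anyFin f)
  found⁻¹ (zero  , f0) = from T-∨ (inj₁ f0)
  found⁻¹ (suc i , fi) = from (T-∨ {f zero}) (inj₂ (from T-anyFin (i , fi)))

1≤∣p∣⇒Nonempty : ∀ {n} (p : Subset n) → 1 ≤ ∣ p ∣ → Nonempty p
1≤∣p∣⇒Nonempty {n} p 1≤∣p∣ with nonempty? p
... | yes ne    = ne
... | no  empty with () ← subst (1 ≤_) (trans (cong ∣_∣ (Empty-unique empty)) (∣⊥∣≡0 n)) 1≤∣p∣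

module Domination {n : ℕ} (G : Graph n) where

  Adj-sym : ∀ {u v} → Adj G u v → Adj G v u
  Adj-sym {u} {v} = subst T (adj-sym G u v)

  Adj-irrefl : ∀ {v} → ¬ Adj G v v
  Adj-irrefl {v} = subst T (adj-irr G v)

  Dominated : Subset n → Fin n → Set
  Dominated D v = v ∈ D ⊎ ∃[ u ] (u ∈ D × Adj G v u)

  Dominates : Subset n → Subset n → Set
  Dominates D W = ∀ v → v ∈ W → Dominated D v

  dominated? : ∀ D v → Dec (Dominated D v)
  dominated? D v = (v ∈? D) ⊎-dec any? (λ u → (u ∈? D) ×-dec T? (adj G v u))

  dominates? : ∀ D W → Dec (Dominates D W)
  dominates? D W = all? (λ v → (v ∈? W) →-dec dominated? D v)

  undominated : ∀ {D W} → ¬ Dominates D W → ∃[ w ] (w ∈ W × ¬ Dominated D w)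
  undominated {D} {W} ¬dom with ¬∀⟶∃¬ n _ (λ v → (v ∈? W) →-dec dominated? D v) ¬dom
  ... | w , ¬dom-w with w ∈? W
  ...   | yes w∈W = w , w∈W , ¬dom-w ∘ λ dom-w _ → dom-w
  ...   | no  w∉W = contradiction (λ w∈W → contradiction w∈W w∉W) ¬dom-w

  record MinimalDominating (R W D : Subset n) : Set where
    field
      R⊆D               : R ⊆ D
      dominates         : Dominates D W
      private-neighbour : ∀ {v} → v ∈ D → v ∉ R → ∃[ w ] (w ∈ W × ¬ Dominated (D - v) w)

  minimise : ∀ {R W} D → R ⊆ D → Dominates D W → ∃[ Y ] (Y ⊆ D × MinimalDominating R W Y)
  minimise D = go D (<-wellFounded ∣ D ∣)
    where
    go : ∀ {R W} D → Acc _<_ ∣ D ∣ → R ⊆ D → Dominates D W → ∃[ Y ] (Y ⊆ D × MinimalDominating R W Y)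
    go {R} {W} D (acc smaller) R⊆D dom
      with any? (λ v → (v ∈? D) ×-dec ¬? (v ∈? R) ×-dec dominates? (D - v) W)
    ... | yes (v , v∈D , v∉R , dom-v) =
      let Y , Y⊆D-v , minimal = go (D - v) (smaller (x∈p⇒∣p-x∣<∣p∣ v∈D)) R⊆D-v dom-v
      in Y , p─q⊆p D ⁅ v ⁆ ∘ Y⊆D-v , minimal
      where
      R⊆D-v : R ⊆ D - v
      R⊆D-v x∈R = x∈p∧x≢y⇒x∈p-y (R⊆D x∈R) λ { refl → v∉R x∈R }
    ... | no irredundant = D , id , record
      { R⊆D               = R⊆D
      ; dominates         = dom
      ; private-neighbour = λ v∈D v∉R → undominated λ dom-v → irredundant (_ , v∈D , v∉R , dom-v)
      }

  open MinimalDominating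

  ∈-complement∪ : ∀ {R W Y : Subset n} {x} → x ∈ W → x ∉ Y → x ∈ (W ∩ ∁ Y) ∪ R
  ∈-complement∪ x∈W x∉Y = x∈p∪q⁺ (inj₁ (x∈p∩q⁺ (x∈W , x∉p⇒x∈∁p x∉Y)))

  ore-complement : ∀ {R W Y} → (∀ {v} → v ∉ R → ∃[ u ] (u ∈ W × Adj G v u)) →
                   MinimalDominating R W Y → Dominates ((W ∩ ∁ Y) ∪ R) W
  -- Either v is its own private neighbour, and then its W-neighbour lies outside Y,
  -- or the private neighbour lies outside Y and its only neighbour in Y is v.
  ore-complement {R} {W} {Y} W-neighbour minimal v v∈W with v ∈? R | v ∈? Y
  ... | yes v∈R | _       = inj₁ (x∈p∪q⁺ (inj₂ v∈R))
  ... | no  _   | no  v∉Y = inj₁ (∈-complement∪ {R} v∈W v∉Y)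
  ... | no  v∉R | yes v∈Y with private-neighbour minimal v∈Y v∉R
  ...   | w , w∈W , ¬dom-w with w ≟ᶠ v
  ...     | yes refl =
    let u , u∈W , vu = W-neighbour v∉R
        u∉Y u∈Y = ¬dom-w (inj₂ (u , x∈p∧x≢y⇒x∈p-y u∈Y (λ u≡v → Adj-irrefl (subst (Adj G v) u≡v vu)) , vu))
    in inj₂ (u , ∈-complement∪ {R} u∈W u∉Y , vu)
  ...     | no w≢v with dominates minimal w w∈W
  ...       | inj₁ w∈Y = contradiction (inj₁ (x∈p∧x≢y⇒x∈p-y w∈Y w≢v)) ¬dom-w
  ...       | inj₂ (u , u∈Y , wu) with u ≟ᶠ v
  ...         | yes refl =
    let w∉Y w∈Y = ¬dom-w (inj₁ (x∈p∧x≢y⇒x∈p-y w∈Y w≢v))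
    in inj₂ (w , ∈-complement∪ {R} w∈W w∉Y , Adj-sym wu)
  ...         | no u≢v = contradiction (inj₂ (u , x∈p∧x≢y⇒x∈p-y u∈Y u≢v , wu)) ¬dom-w

  ore-bound : ∀ {R W} → R ⊆ W → (∀ {v} → v ∉ R → ∃[ u ] (u ∈ W × Adj G v u)) →
              ∃[ D ] ((R ⊆ D × Dominates D W) × 2 * ∣ D ∣ ≤ ∣ W ∣ + ∣ R ∣)
  ore-bound {R} {W} R⊆W W-neighbour =
    let Y , Y⊆W , minimal = minimise W R⊆W (λ _ → inj₁)
    in smaller-of-two {P = λ D → R ⊆ D × Dominates D W} Y ((W ∩ ∁ Y) ∪ R)
         (R⊆D minimal , dominates minimal)
         (q⊆p∪q (W ∩ ∁ Y) R , ore-complement W-neighbour minimal)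
         (∣q∣+∣[p∩∁q]∪r∣≡∣p∣+∣r∣ (R⊆D minimal) Y⊆W)

module _ {n : ℕ} (F : Graph n) where

  ∈-Deg≥2 : ∀ {v} → v ∈ Deg≥2 F ⇔ 2 ≤ degree F v
  ∈-Deg≥2 = mk⇔ (≤ᵇ⇒≤ 2 _ ∘ to ∈-tabulate) (from ∈-tabulate ∘ ≤⇒≤ᵇ)

  ∈-Supp : ∀ {v} → v ∈ Supp F ⇔ (∃[ u ] (Adj F v u × IsLeaf F u))
  ∈-Supp = mk⇔ leaf-neighbour (from ∈-tabulate ∘ from T-anyFin ∘ witness)
    where
    leaf-neighbour : ∀ {v} → v ∈ Supp F → ∃[ u ] (Adj F v u × IsLeaf F u)
    leaf-neighbour v∈S with to T-anyFin (to ∈-tabulate v∈S)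
    ... | u , t = let vu , leaf = to T-∧ t in u , vu , ≡ᵇ⇒≡ _ 1 leaf
    witness : ∀ {v} → ∃[ u ] (Adj F v u × IsLeaf F u) → ∃[ u ] T (adj F v u ∧ (degree F u ≡ᵇ 1))
    witness (u , vu , leaf) = u , from T-∧ (vu , ≡⇒≡ᵇ _ 1 leaf)

module LeavesAndSupports {n : ℕ} (F : Graph n) (no-isolated : NoIsolated F) where
  open Domination F using (Adj-sym; Dominates)

  H S : Subset n
  H = Deg≥2 F
  S = Supp F

  neighbour : ∀ v → ∃[ u ] Adj F v u
  neighbour v = let u , u∈N = 1≤∣p∣⇒Nonempty (nbhd F v) (no-isolated v) in u , to ∈-tabulate u∈N

  leaf-or-branch : ∀ v → IsLeaf F v ⊎ v ∈ H
  leaf-or-branch v with m≤n⇒m<n∨m≡n (no-isolated v)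
  ... | inj₁ 2≤deg = inj₂ (from (∈-Deg≥2 F) 2≤deg)
  ... | inj₂ 1≡deg = inj₁ (sym 1≡deg)

  support : ∀ {u v} → Adj F v u → IsLeaf F u → v ∈ S
  support vu leaf = from (∈-Supp F) (_ , vu , leaf)

  core-neighbour : ∀ {v} → v ∉ H ∩ S → ∃[ u ] (u ∈ H ∪ S × Adj F v u)
  core-neighbour {v} v∉R with neighbour v | leaf-or-branch v
  ... | u , vu | inj₁ v-leaf = u , x∈p∪q⁺ (inj₂ (support (Adj-sym vu) v-leaf)) , vu
  ... | u , vu | inj₂ v∈H with leaf-or-branch u
  ...   | inj₁ u-leaf = contradiction (x∈p∩q⁺ (v∈H , support vu u-leaf)) v∉R
  ...   | inj₂ u∈H    = u , x∈p∪q⁺ (inj₁ u∈H) , vu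

  R-neighbour : ∀ {v} → v ∉ H ∪ S → ∃[ u ] (u ∈ H ∩ S × Adj F v u)
  R-neighbour {v} v∉W with neighbour v | leaf-or-branch v
  ... | _      | inj₂ v∈H    = contradiction (x∈p∪q⁺ (inj₁ v∈H)) v∉W
  ... | u , vu | inj₁ v-leaf with leaf-or-branch u
  ...   | inj₁ u-leaf = contradiction (x∈p∪q⁺ (inj₂ (support vu u-leaf))) v∉W
  ...   | inj₂ u∈H    = u , x∈p∩q⁺ (u∈H , support (Adj-sym vu) v-leaf) , vu

  dominating : ∀ {D} → H ∩ S ⊆ D → Dominates D (H ∪ S) → Dominating F D
  dominating R⊆D dom v with v ∈? H ∪ S
  ... | yes v∈W = dom v v∈W
  ... | no  v∉W = let u , u∈R , vu = R-neighbour v∉W in inj₂ (u , R⊆D u∈R , vu)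

proposition3 : ∀ (n : ℕ) (F : Graph n) → IsForest F → NoIsolated F →
    Σ (Subset n) λ D → Dominating F D × 2 * ∣ D ∣ ≤ ∣ Deg≥2 F ∣ + ∣ Supp F ∣
proposition3 n F _ no-isolated =
  let D , (R⊆D , dom) , bound =
        ore-bound {R = H ∩ S} {W = H ∪ S} (⊆-trans (p∩q⊆p H S) (p⊆p∪q S)) core-neighbour
  in D , dominating R⊆D dom , subst (2 * ∣ D ∣ ≤_) (∣p∪q∣+∣p∩q∣≡∣p∣+∣q∣ H S) bound
  where
  open Domination F using (ore-bound)
  open LeavesAndSupports F no-isolated
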